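{- Let $n\ge 2$ and let $T$ be a rooted tree on the vertex set $\{1,\dots,n\}$ with slither code $(s_1,\dots,s_{n-1})$. Let $\alpha$ be the smallest number such that $(s_1,\dots,s_\alpha)$ contains at least $n-\alpha$ distinct numbers, and suppose that $(s_1,\dots,s_\alpha)$ contains exactly $n-\alpha$ distinct numbers. Then the root of $T$ is an $N$-position. If $\alpha+1\le n-1$ and $s_{\alpha+1}$ occurs in $(s_1,\dots,s_\alpha)$, then $s_{\alpha+1}$ is the root; if $\alpha+1\le n-1$ and $s_{\alpha+1}$ does not occur in $(s_1,\dots,s_\alpha)$, then $s_\alpha$ is the root. The $\alpha$ vertices not occurring in $(s_1,\dots,s_\alpha)$ are exactly the $P$-positions, and they constitute a maximum independent set of $T$.
   Context: Edges of $T$ are directed away from the root. A vertex is a $P$-position iff none of its children is a $P$-position (leaves are $P$-positions); otherwise it is an $N$-position. Slither code: start with $n-1$ empty slots; repeat $n-1$ times: among non-root vertices of the current tree with no remaining children, remove the one with smallest label and put its label into the leftmost empty slot if it is a $P$-position of the original tree $T$, otherwise into the rightmost empty slot. This gives $(a_1,\dots,a_{n-1})$; then $s_i$ is the parent of $a_i$ in $T$. -}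

module Defs where

open import Data.Nat using (ℕ; zero; suc; _∸_; _≤_)
open import Data.Fin using (Fin) renaming (_≤_ to _≤ᶠ_)
open import Data.Fin.Properties using () renaming (_≟_ to _≟ᶠ_)
open import Data.List using (List; []; _∷_; _++_; reverse; map; length; take; deduplicate)
open import Data.List.Membership.Propositional using (_∈_; _∉_)
open import Data.Fin.Subset as S using (Subset; ∣_∣)
open import Data.Product using (Σ; ∃; _×_; _,_)
open import Relation.Binary.PropositionalEquality using (_≡_; _≢_)
open import Relation.Nullary using (¬_)
open import Function.Bundles using (_⇔_)

iter : {A : Set} → (A → A) → ℕ → A → A
iter f zero    x = x
iter f (suc k) x = f (iter f k x)

-- A rooted tree on the vertex set {1,…,n}, encoded as Fin n (label i+1 ↦ i,
-- so the order of labels is the order of Fin n).  Every non-root vertex v has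
-- parent (parent v); by convention parent root ≡ root.  Every vertex reaches the
-- root by following parents (so the parent graph is a tree rooted at root).
record RootedTree (n : ℕ) : Set where
  field
    root        : Fin n
    parent      : Fin n → Fin n
    parent-root : parent root ≡ root
    reaches     : ∀ v → ∃ λ k → iter parent k v ≡ root

module _ {n : ℕ} (T : RootedTree n) where
  open RootedTree T

  Child : Fin n → Fin n → Set
  Child u v = u ≢ root × parent u ≡ v

  data IsP : Fin n → Set
  data IsN : Fin n → Set
  data IsP where
    p-pos : ∀ {v} → (∀ u → Child u v → IsN u) → IsP v
  data IsN where
    n-pos : ∀ {v} u → Child u v → IsP u → IsN v

  Removable : List (Fin n) → Fin n → Set
  Removable removed v = v ≢ root × v ∉ removed × (∀ u → Child u v → u ∈ removed)

  data Greedy : List (Fin n) → List (Fin n) → Set where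
    done : ∀ {removed} → Greedy removed []
    step : ∀ {removed v rest} →
           Removable removed v →
           (∀ w → Removable removed w → v ≤ᶠ w) →
           Greedy (v ∷ removed) rest →
           Greedy removed (v ∷ rest)

  data Split : List (Fin n) → List (Fin n) → List (Fin n) → Set where
    []  : Split [] [] []
    ←P  : ∀ {x xs ps ns} → IsP x → Split xs ps ns → Split (x ∷ xs) (x ∷ ps) ns
    ←N  : ∀ {x xs ps ns} → IsN x → Split xs ps ns → Split (x ∷ xs) ps (x ∷ ns)

  -- s is the slither code of T.  ord is the removal order (n-1 removals);
  -- P-positions fill the slots from the left in removal order, N-positions
  -- fill the slots from the right, so a = ps ++ reverse ns; s_i = parent a_i.
  SlitherCode : List (Fin n) → Set
  SlitherCode s =
    Σ (List (Fin n)) λ ord → Σ (List (Fin n)) λ ps → Σ (List (Fin n)) λ ns →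
      Greedy [] ord × length ord ≡ n ∸ 1 × Split ord ps ns ×
      s ≡ map parent (ps ++ reverse ns)

  Independent : Subset n → Set
  Independent I = ∀ u v → u S.∈ I → v S.∈ I → ¬ Child u v

  MaximumIndependent : Subset n → Set
  MaximumIndependent I = Independent I × (∀ J → Independent J → ∣ J ∣ ≤ ∣ I ∣)

#distinct : {n : ℕ} → List (Fin n) → ℕ
#distinct xs = length (deduplicate _≟ᶠ_ xs)

-- Let p be the number of P-positions other than the root.  The P-positions fill the first p slots,
-- and their parents are exactly the N-positions, so D β := #distinct (s₁,…,s_β) is monotone and
-- D p counts the N-positions.  If the root is an N-position, D p = n − p, and monotonicity forces α = p;
-- the vertices missing from (s₁,…,s_p) are then the P-positions, which are independent, and sending each
-- vertex to a P-child (or to itself when it has none) injects every independent set into them.  If the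
-- root were a P-position, then D p = n − p − 1 while s_{p+1}, the parent of the last removed N-position,
-- is a P-position, so D (p+1) = n − p: the sequence jumps over the line n − β and no α exists.
-- The slots of the N-positions are filled from the right, so s_α, s_{α+1} are the parents of the last
-- removed P- and N-positions, and every vertex removed after the last N-position is a P-position.

module Submission where

open import Defs
open import Data.Nat using (ℕ; zero; suc; _+_; _∸_; _≤_; _<_; z≤n; s≤s)
open import Data.Nat.Properties
  using (module ≤-Reasoning; <⇒≤; ≤-refl; ≤-trans; m≤m+n; n≤1+n; ≤-antisym; <-irrefl; <-asym; <-cmp; ∸-monoʳ-≤; ∸-monoʳ-<;
         +-suc; +-cancelˡ-≤; m+n∸m≡n; m+n∸n≡m; m+[n∸m]≡n; m<n⇒0<n∸m; 1+n≰n)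
open import Data.Fin using (Fin; zero; suc)
open import Data.Fin.Properties using (any?; suc-injective; 0≢1+n) renaming (_≟_ to _≟ᶠ_)
open import Data.Fin.Subset as S using (Subset; ∣_∣; inside; outside)
open import Data.Vec using ([]; _∷_; here; there)
open import Data.List using (List; []; _∷_; _++_; _∷ʳ_; map; length; take; drop; reverse; allFin; initLast; _∷ʳ′_)
open import Data.List.Properties
  using (length-map; length-++; length-tabulate; map-++; reverse-++; ++-assoc; ∷-injective; ∷ʳ-injectiveʳ)
open import Data.List.Membership.Propositional using (_∈_; _∉_)
open import Data.List.Membership.Propositional.Properties
  using (∈-map⁺; ∈-map⁻; ∈-++⁺ˡ; ∈-++⁺ʳ; ∈-++⁻; ∈-allFin; ∈-deduplicate⁺; ∈-deduplicate⁻)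
open import Data.List.Relation.Binary.Subset.Propositional using (_⊆_)
open import Data.List.Relation.Unary.Any using (here; there)
open import Data.List.Relation.Unary.All as All using (All; []; _∷_)
open import Data.List.Relation.Unary.AllPairs using ([]; _∷_)
open import Data.List.Relation.Unary.Unique.Propositional using (Unique)
import Data.List.Membership.DecPropositional as DecMembership
import Data.List.Relation.Unary.Unique.DecPropositional.Properties as DecUnique
open import Data.Product using (∃; ∃₂; _×_; _,_; proj₁; proj₂)
open import Data.Sum using (_⊎_; inj₁; inj₂)
open import Data.Empty using (⊥; ⊥-elim)
open import Function.Bundles using (_⇔_; mk⇔; Equivalence)
import Function.Properties.Equivalence as ⇔
open import Relation.Binary using (tri<; tri≈; tri>)
open import Relation.Binary.PropositionalEquality using (_≡_; _≢_; refl; sym; trans; cong; subst; subst₂; cong₂; module ≡-Reasoning)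
open import Relation.Nullary using (¬_; Dec; yes; no)

module _ {A : Set} where

  ∈-remove : ∀ {x : A} {ys} → x ∈ ys →
             ∃ λ ys′ → length ys ≡ suc (length ys′) × (∀ {z} → z ∈ ys → z ≢ x → z ∈ ys′)
  ∈-remove {ys = y ∷ ys} (here refl) = ys , refl , λ { (here z≡x) z≢x → ⊥-elim (z≢x z≡x) ; (there z∈) _ → z∈ }
  ∈-remove {ys = y ∷ ys} (there x∈) with ys′ , len , keep ← ∈-remove x∈ =
    y ∷ ys′ , cong suc len , λ { (here z≡y) _ → here z≡y ; (there z∈) z≢x → there (keep z∈ z≢x) }

  Unique⇒length-≤ : ∀ {xs ys : List A} → Unique xs → xs ⊆ ys → length xs ≤ length ys
  Unique⇒length-≤ {[]}     _          _   = z≤n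
  Unique⇒length-≤ {x ∷ xs} (x∉xs ∷ u) sub with ys′ , len , keep ← ∈-remove (sub (here refl)) =
    subst (suc (length xs) ≤_) (sym len)
      (s≤s (Unique⇒length-≤ u λ z∈xs → keep (sub (there z∈xs)) λ z≡x → All.lookup x∉xs z∈xs (sym z≡x)))

  Unique⇒length-≡ : ∀ {xs ys : List A} → Unique xs → Unique ys → xs ⊆ ys → ys ⊆ xs → length xs ≡ length ys
  Unique⇒length-≡ uxs uys xs⊆ys ys⊆xs = ≤-antisym (Unique⇒length-≤ uxs xs⊆ys) (Unique⇒length-≤ uys ys⊆xs)

  Unique-map⁺ : ∀ {B : Set} (f : A → B) {xs} → (∀ {x y} → x ∈ xs → y ∈ xs → f x ≡ f y → x ≡ y) →
                Unique xs → Unique (map f xs)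
  Unique-map⁺ f {[]}     _   []         = []
  Unique-map⁺ f {x ∷ xs} inj (x∉xs ∷ u) =
    All.tabulate (λ fy∈ fx≡fy → let y , y∈ , fy≡ = ∈-map⁻ f fy∈ in
                               All.lookup x∉xs y∈ (inj (here refl) (there y∈) (trans fx≡fy fy≡)))
    ∷ Unique-map⁺ f (λ x∈ y∈ → inj (there x∈) (there y∈)) u

  take-mono-⊆ : ∀ {β γ} → β ≤ γ → (xs : List A) → take β xs ⊆ take γ xs
  take-mono-⊆ (s≤s β≤γ) (x ∷ xs) (here z≡x) = here z≡x
  take-mono-⊆ (s≤s β≤γ) (x ∷ xs) (there z∈) = there (take-mono-⊆ β≤γ xs z∈)

  take-length-++ : ∀ (xs ys : List A) → take (length xs) (xs ++ ys) ≡ xs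
  take-length-++ []       ys = refl
  take-length-++ (x ∷ xs) ys = cong (x ∷_) (take-length-++ xs ys)

  take-suc-length-++ : ∀ (xs : List A) y ys → take (suc (length xs)) (xs ++ y ∷ ys) ≡ xs ∷ʳ y
  take-suc-length-++ []       y ys = refl
  take-suc-length-++ (x ∷ xs) y ys = cong (x ∷_) (take-suc-length-++ xs y ys)

  drop-length-++ : ∀ (xs ys : List A) → drop (length xs) (xs ++ ys) ≡ ys
  drop-length-++ []       ys = refl
  drop-length-++ (x ∷ xs) ys = drop-length-++ xs ys

  ∷ʳ-view : ∀ (xs : List A) → 0 < length xs → ∃₂ λ ys y → xs ≡ ys ∷ʳ y
  ∷ʳ-view xs pos with initLast xs
  ... | ys ∷ʳ′ y = ys , y , refl

  ∈⇒length>0 : ∀ {x : A} {xs} → x ∈ xs → 0 < length xs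
  ∈⇒length>0 (here _)  = s≤s z≤n
  ∈⇒length>0 (there _) = s≤s z≤n

module _ {n : ℕ} where
  open DecUnique (_≟ᶠ_ {n}) using (deduplicate-!)

  #distinct-mono : {xs ys : List (Fin n)} → xs ⊆ ys → #distinct xs ≤ #distinct ys
  #distinct-mono {xs} xs⊆ys =
    Unique⇒length-≤ (deduplicate-! xs) λ z∈ → ∈-deduplicate⁺ _≟ᶠ_ (xs⊆ys (∈-deduplicate⁻ _≟ᶠ_ xs z∈))

  #distinct-Unique : {xs ys : List (Fin n)} → Unique ys → xs ⊆ ys → ys ⊆ xs → #distinct xs ≡ length ys
  #distinct-Unique {xs} uys xs⊆ys ys⊆xs =
    Unique⇒length-≡ (deduplicate-! xs) uys
      (λ z∈ → xs⊆ys (∈-deduplicate⁻ _≟ᶠ_ xs z∈)) (λ z∈ → ∈-deduplicate⁺ _≟ᶠ_ (ys⊆xs z∈))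

elements : ∀ {n} → Subset n → List (Fin n)
elements []            = []
elements (inside  ∷ p) = zero ∷ map suc (elements p)
elements (outside ∷ p) = map suc (elements p)

length-elements : ∀ {n} (p : Subset n) → length (elements p) ≡ ∣ p ∣
length-elements []            = refl
length-elements (inside  ∷ p) = cong suc (trans (length-map suc (elements p)) (length-elements p))
length-elements (outside ∷ p) = trans (length-map suc (elements p)) (length-elements p)

∈-elements⁺ : ∀ {n} {p : Subset n} {x} → x S.∈ p → x ∈ elements p
∈-elements⁺ {p = inside  ∷ p} here      = here refl
∈-elements⁺ {p = inside  ∷ p} (there x∈) = there (∈-map⁺ suc (∈-elements⁺ x∈))
∈-elements⁺ {p = outside ∷ p} (there x∈) = ∈-map⁺ suc (∈-elements⁺ x∈)

∈-elements⁻ : ∀ {n} {p : Subset n} {x} → x ∈ elements p → x S.∈ p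
∈-elements⁻ {p = inside  ∷ p} (here refl) = here
∈-elements⁻ {p = inside  ∷ p} (there x∈) with _ , y∈ , refl ← ∈-map⁻ suc x∈ = there (∈-elements⁻ y∈)
∈-elements⁻ {p = outside ∷ p} x∈          with _ , y∈ , refl ← ∈-map⁻ suc x∈ = there (∈-elements⁻ y∈)

elements-Unique : ∀ {n} (p : Subset n) → Unique (elements p)
elements-Unique []            = []
elements-Unique (inside  ∷ p) =
  All.tabulate (λ x∈ 0≡x → let _ , _ , x≡ = ∈-map⁻ suc x∈ in 0≢1+n (trans 0≡x x≡))
  ∷ Unique-map⁺ suc (λ _ _ → suc-injective) (elements-Unique p)
elements-Unique (outside ∷ p) = Unique-map⁺ suc (λ _ _ → suc-injective) (elements-Unique p)

module Threshold (D : ℕ → ℕ) (D-mono : ∀ {β γ} → β ≤ γ → D β ≤ D γ) {n α : ℕ}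
                 (below : ∀ β → β < α → D β < n ∸ β) (at : D α ≡ n ∸ α) where

  open ≤-Reasoning

  threshold-unique : ∀ {γ} → γ ≤ n → D γ ≡ n ∸ γ → α ≡ γ
  threshold-unique {γ} γ≤n Dγ≡ with <-cmp α γ
  ... | tri≈ _ α≡γ _ = α≡γ
  ... | tri> _ _ γ<α = ⊥-elim (<-irrefl Dγ≡ (below γ γ<α))
  ... | tri< α<γ _ _ = ⊥-elim (<-irrefl at (begin-strict
    D α     ≤⟨ D-mono (<⇒≤ α<γ) ⟩
    D γ     ≡⟨ Dγ≡ ⟩
    n ∸ γ   <⟨ ∸-monoʳ-< α<γ γ≤n ⟩
    n ∸ α   ∎))

  threshold-not-jumped : ∀ {γ} → D γ < n ∸ γ → n ∸ suc γ < D (suc γ) → ⊥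
  threshold-not-jumped {γ} Dγ< <Dγ+1 with <-cmp α (suc γ)
  ... | tri≈ _ refl _ = <-irrefl (sym at) <Dγ+1
  ... | tri> _ _ γ<α  = <-asym (below (suc γ) γ<α) <Dγ+1
  ... | tri< (s≤s α≤γ) _ _ = <-irrefl at (begin-strict
    D α     ≤⟨ D-mono α≤γ ⟩
    D γ     <⟨ Dγ< ⟩
    n ∸ γ   ≤⟨ ∸-monoʳ-≤ n α≤γ ⟩
    n ∸ α   ∎)

module _ {n : ℕ} (T : RootedTree n) where
  open RootedTree T

  iter-fixed : ∀ {v} → parent v ≡ v → ∀ k → iter parent k v ≡ v
  iter-fixed pv≡v zero    = refl
  iter-fixed pv≡v (suc k) = trans (cong parent (iter-fixed pv≡v k)) pv≡v

  parent≢self : ∀ {v} → v ≢ root → parent v ≢ v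
  parent≢self {v} v≢root pv≡v with k , reach ← reaches v = v≢root (trans (sym (iter-fixed pv≡v k)) reach)

  P⇒¬N : ∀ {v} → IsP T v → ¬ IsN T v
  P⇒¬N (p-pos children-N) (n-pos u u→v uP) = P⇒¬N uP (children-N u u→v)

  P⇒children-N : ∀ {v} → IsP T v → ∀ u → Child T u v → IsN T u
  P⇒children-N (p-pos children-N) = children-N

  N⇒P-child : ∀ {v} → IsN T v → ∃ λ u → Child T u v × IsP T u
  N⇒P-child (n-pos u u→v uP) = u , u→v , uP

  Child? : ∀ u v → Dec (Child T u v)
  Child? u v with u ≟ᶠ root | parent u ≟ᶠ v
  ... | yes u≡root | _        = no λ (u≢root , _) → u≢root u≡root
  ... | no u≢root  | yes pu≡v = yes (u≢root , pu≡v)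
  ... | no _       | no pu≢v  = no λ (_ , pu≡v) → pu≢v pu≡v

  PorN : Fin n → Set
  PorN v = IsP T v ⊎ IsN T v

  P-child? : ∀ v → (∀ u → Child T u v → PorN u) → ∀ u → Dec (Child T u v × IsP T u)
  P-child? v classified u with Child? u v
  ... | no ¬u→v = no λ (u→v , _) → ¬u→v u→v
  ... | yes u→v with classified u u→v
  ...   | inj₁ uP = yes (u→v , uP)
  ...   | inj₂ uN = no λ (_ , uP) → P⇒¬N uP uN

  classify-from-children : ∀ v → (∀ u → Child T u v → PorN u) → PorN v
  classify-from-children v classified with any? (P-child? v classified)
  ... | yes (u , u→v , uP) = inj₂ (n-pos u u→v uP)
  ... | no ∄P-child = inj₁ (p-pos λ u u→v → child-N u u→v (classified u u→v))
    where
    child-N : ∀ u → Child T u v → PorN u → IsN T u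
    child-N u u→v (inj₁ uP) = ⊥-elim (∄P-child (u , u→v , uP))
    child-N u u→v (inj₂ uN) = uN

  P-positions-Independent : ∀ (I : Subset n) → (∀ {v} → v S.∈ I → IsP T v) → Independent T I
  P-positions-Independent I ⊆P u v u∈ v∈ u→v = P⇒¬N (⊆P v∈) (n-pos u u→v (⊆P u∈))

  Greedy-∉ : ∀ {R ord} → Greedy T R ord → ∀ {x} → x ∈ ord → x ∉ R
  Greedy-∉ (step (_ , x∉R , _) _ _) (here refl) = x∉R
  Greedy-∉ (step _ _ g)            (there x∈)  = λ x∈R → Greedy-∉ g x∈ (there x∈R)

  Greedy-≢root : ∀ {R ord} → Greedy T R ord → ∀ {x} → x ∈ ord → x ≢ root
  Greedy-≢root (step (x≢root , _) _ _) (here refl) = x≢root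
  Greedy-≢root (step _ _ g)            (there x∈)  = Greedy-≢root g x∈

  Greedy-Unique : ∀ {R ord} → Greedy T R ord → Unique ord
  Greedy-Unique done         = []
  Greedy-Unique (step _ _ g) = All.tabulate (λ y∈ x≡y → Greedy-∉ g y∈ (here (sym x≡y))) ∷ Greedy-Unique g

  Greedy-classify : ∀ {R ord} → Greedy T R ord → (∀ {x} → x ∈ R → PorN x) → ∀ {x} → x ∈ ord → PorN x
  Greedy-classify {R} (step {v = v} (_ , _ , children-removed) _ g) R-classified =
    λ { (here refl) → v-classified ; (there x∈) → Greedy-classify g vR-classified x∈ }
    where
    v-classified : PorN v
    v-classified = classify-from-children v λ u u→v → R-classified (children-removed u u→v)
    vR-classified : ∀ {x} → x ∈ v ∷ R → PorN x
    vR-classified (here refl)  = v-classified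
    vR-classified (there x∈R) = R-classified x∈R

  ChildClosed : List (Fin n) → Set
  ChildClosed R = ∀ {u v} → v ∈ R → Child T u v → u ∈ R

  -- When w is removed its parent still has the child w, so the parent is removed later.
  parent-removed-later : ∀ {R ord} → Greedy T R ord → ChildClosed R → (∀ v → v ≢ root → v ∈ R ⊎ v ∈ ord) →
                         ∀ A w B → ord ≡ A ++ w ∷ B → parent w ≢ root → parent w ∈ B
  parent-removed-later (step (w≢root , w∉R , _) _ _) closed covered [] w B refl pw≢root
    with covered (parent w) pw≢root
  ... | inj₁ pw∈R         = ⊥-elim (w∉R (closed pw∈R (w≢root , refl)))
  ... | inj₂ (here pw≡w)  = ⊥-elim (parent≢self w≢root pw≡w)
  ... | inj₂ (there pw∈B) = pw∈B
  parent-removed-later {R} (step {v = a} (_ , _ , children-removed) _ g) closed covered (a ∷ A) w B refl pw≢root =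
    parent-removed-later g closed′ covered′ A w B refl pw≢root
    where
    closed′ : ChildClosed (a ∷ R)
    closed′ (here refl)  u→a = there (children-removed _ u→a)
    closed′ (there v∈R) u→v = there (closed v∈R u→v)
    covered′ : ∀ v → v ≢ root → v ∈ a ∷ R ⊎ v ∈ A ++ w ∷ B
    covered′ v v≢root with covered v v≢root
    ... | inj₁ v∈R         = inj₁ (there v∈R)
    ... | inj₂ (here v≡a)  = inj₁ (here v≡a)
    ... | inj₂ (there v∈)  = inj₂ v∈

  Split-∈ : ∀ {ord ps ns} → Split T ord ps ns → ∀ {x} → x ∈ ord → x ∈ ps ⊎ x ∈ ns
  Split-∈ (←P _ _)  (here refl) = inj₁ (here refl)
  Split-∈ (←N _ _)  (here refl) = inj₂ (here refl)
  Split-∈ (←P _ sp) (there x∈) with Split-∈ sp x∈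
  ... | inj₁ x∈ps = inj₁ (there x∈ps)
  ... | inj₂ x∈ns = inj₂ x∈ns
  Split-∈ (←N _ sp) (there x∈) with Split-∈ sp x∈
  ... | inj₁ x∈ps = inj₁ x∈ps
  ... | inj₂ x∈ns = inj₂ (there x∈ns)

  Split-P : ∀ {ord ps ns} → Split T ord ps ns → ∀ {x} → x ∈ ps → IsP T x × x ∈ ord
  Split-P (←P xP _)  (here refl) = xP , here refl
  Split-P (←P _ sp)  (there x∈)  = let xP , x∈ord = Split-P sp x∈ in xP , there x∈ord
  Split-P (←N _ sp)  x∈          = let xP , x∈ord = Split-P sp x∈ in xP , there x∈ord

  Split-N : ∀ {ord ps ns} → Split T ord ps ns → ∀ {x} → x ∈ ns → IsN T x × x ∈ ord
  Split-N (←N xN _)  (here refl) = xN , here refl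
  Split-N (←N _ sp)  (there x∈)  = let xN , x∈ord = Split-N sp x∈ in xN , there x∈ord
  Split-N (←P _ sp)  x∈          = let xN , x∈ord = Split-N sp x∈ in xN , there x∈ord

  Split-Unique-P : ∀ {ord ps ns} → Split T ord ps ns → Unique ord → Unique ps
  Split-Unique-P []         _          = []
  Split-Unique-P (←P _ sp) (x∉ ∷ u) =
    All.tabulate (λ y∈ → All.lookup x∉ (proj₂ (Split-P sp y∈))) ∷ Split-Unique-P sp u
  Split-Unique-P (←N _ sp) (_  ∷ u) = Split-Unique-P sp u

  Split-Unique-N : ∀ {ord ps ns} → Split T ord ps ns → Unique ord → Unique ns
  Split-Unique-N []         _          = []
  Split-Unique-N (←N _ sp) (x∉ ∷ u) =
    All.tabulate (λ y∈ → All.lookup x∉ (proj₂ (Split-N sp y∈))) ∷ Split-Unique-N sp u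
  Split-Unique-N (←P _ sp) (_  ∷ u) = Split-Unique-N sp u

  Split-length : ∀ {ord ps ns} → Split T ord ps ns → length ord ≡ length ps + length ns
  Split-length []        = refl
  Split-length (←P _ sp) = cong suc (Split-length sp)
  Split-length {ps = ps} {ns = _ ∷ ns} (←N _ sp) =
    trans (cong suc (Split-length sp)) (sym (+-suc (length ps) (length ns)))

  Split-no-N : ∀ {ord ps} → Split T ord ps [] → ps ≡ ord × All (IsP T) ord
  Split-no-N []        = refl , []
  Split-no-N (←P xP sp) with refl , allP ← Split-no-N sp = refl , xP ∷ allP

  Split-after-last-N : ∀ {ord ps} ns w → Split T ord ps (ns ∷ʳ w) →
    ∃ λ A → ∃₂ λ B ps₀ → ord ≡ A ++ w ∷ B × ps ≡ ps₀ ++ B × All (IsP T) B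
  Split-after-last-N [] w (←P {x = x} _ sp)
    with A , B , ps₀ , refl , refl , allP ← Split-after-last-N [] w sp = x ∷ A , B , x ∷ ps₀ , refl , refl , allP
  Split-after-last-N (y ∷ ns) w (←P {x = x} _ sp)
    with A , B , ps₀ , refl , refl , allP ← Split-after-last-N (y ∷ ns) w sp = x ∷ A , B , x ∷ ps₀ , refl , refl , allP
  Split-after-last-N [] w (←N _ sp)
    with refl , allP ← Split-no-N sp = [] , _ , [] , refl , refl , allP
  Split-after-last-N (x ∷ ns) w (←N _ sp)
    with A , B , ps₀ , refl , refl , allP ← Split-after-last-N ns w sp = x ∷ A , B , ps₀ , refl , refl , allP

module RemovalOrder {n : ℕ} (T : RootedTree n) (n≥2 : 2 ≤ n) {ord ps ns : List (Fin n)}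
               (G : Greedy T [] ord) (len : length ord ≡ n ∸ 1) (sp : Split T ord ps ns) where
  open RootedTree T
  open DecMembership (_≟ᶠ_ {n}) using (_∈?_)

  p q : ℕ
  p = length ps
  q = length ns

  n∸1≡p+q : n ∸ 1 ≡ p + q
  n∸1≡p+q = trans (sym len) (Split-length T sp)

  n≡1+p+q : n ≡ suc (p + q)
  n≡1+p+q = trans (sym (m+[n∸m]≡n (<⇒≤ n≥2))) (cong suc n∸1≡p+q)

  n∸p≡1+q : n ∸ p ≡ suc q
  n∸p≡1+q = trans (cong (_∸ p) (trans n≡1+p+q (sym (+-suc p q)))) (m+n∸m≡n p (suc q))

  n∸1+p≡q : n ∸ suc p ≡ q
  n∸1+p≡q = trans (cong (_∸ suc p) n≡1+p+q) (m+n∸m≡n p q)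

  removed-all : ∀ v → v ≢ root → v ∈ ord
  removed-all v v≢root with v ∈? ord
  ... | yes v∈ = v∈
  ... | no v∉ = ⊥-elim (1+n≰n (begin
    suc n                    ≡⟨ cong suc n≡1+p+q ⟩
    suc (suc (p + q))        ≡⟨ cong (λ k → suc (suc k)) (sym (Split-length T sp)) ⟩
    length (root ∷ v ∷ ord)  ≤⟨ Unique⇒length-≤ all-distinct (λ {z} _ → ∈-allFin z) ⟩
    length (allFin n)        ≡⟨ length-tabulate (λ i → i) ⟩
    n                        ∎))
    where
    open ≤-Reasoning
    all-distinct : Unique (root ∷ v ∷ ord)
    all-distinct = ((λ root≡v → v≢root (sym root≡v)) ∷ All.tabulate (λ x∈ root≡x → Greedy-≢root T G x∈ (sym root≡x)))
                 ∷ All.tabulate (λ x∈ v≡x → v∉ (subst (_∈ ord) (sym v≡x) x∈)) ∷ Greedy-Unique T G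

  classify : ∀ v → PorN T v
  classify v = classify-from-children T v λ u u→v → Greedy-classify T G (λ ()) (removed-all u (proj₁ u→v))

  P⇒∈ps : ∀ {v} → IsP T v → v ≢ root → v ∈ ps
  P⇒∈ps vP v≢root with Split-∈ T sp (removed-all _ v≢root)
  ... | inj₁ v∈ps = v∈ps
  ... | inj₂ v∈ns = ⊥-elim (P⇒¬N T vP (proj₁ (Split-N T sp v∈ns)))

  N⇒∈ns : ∀ {v} → IsN T v → v ≢ root → v ∈ ns
  N⇒∈ns vN v≢root with Split-∈ T sp (removed-all _ v≢root)
  ... | inj₁ v∈ps = ⊥-elim (P⇒¬N T (proj₁ (Split-P T sp v∈ps)) vN)
  ... | inj₂ v∈ns = v∈ns

  ns-≢root : ∀ {v} → v ∈ ns → v ≢ root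
  ns-≢root v∈ = Greedy-≢root T G (proj₂ (Split-N T sp v∈))

  parent-later : ∀ A w B → ord ≡ A ++ w ∷ B → parent w ≢ root → parent w ∈ B
  parent-later = parent-removed-later T G (λ ()) (λ v v≢root → inj₂ (removed-all v v≢root))

  last-removed-child-of-root : ∀ A c → ord ≡ A ∷ʳ c → parent c ≡ root
  last-removed-child-of-root A c ord≡ with parent c ≟ᶠ root
  ... | yes pc≡root = pc≡root
  ... | no pc≢root with () ← parent-later A c [] ord≡ pc≢root

  parents : List (Fin n)
  parents = map parent ps

  ∈parents⇒N : ∀ {v} → v ∈ parents → IsN T v
  ∈parents⇒N v∈ with u , u∈ps , refl ← ∈-map⁻ parent v∈ =
    n-pos u (Greedy-≢root T G (proj₂ (Split-P T sp u∈ps)) , refl) (proj₁ (Split-P T sp u∈ps))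

  N⇒∈parents : ∀ {v} → IsN T v → v ∈ parents
  N⇒∈parents (n-pos u (u≢root , refl) uP) = ∈-map⁺ parent (P⇒∈ps uP u≢root)

  code : List (Fin n)
  code = map parent (ps ++ reverse ns)

  take-p-code : take p code ≡ parents
  take-p-code = trans (cong₂ take (sym (length-map parent ps)) (map-++ parent ps (reverse ns)))
                      (take-length-++ parents _)

  D : ℕ → ℕ
  D β = #distinct (take β code)

  D-mono : ∀ {β γ} → β ≤ γ → D β ≤ D γ
  D-mono β≤γ = #distinct-mono (take-mono-⊆ β≤γ code)

  code-after-last-N : ∀ {ns′ w} → ns ≡ ns′ ∷ʳ w → code ≡ parents ++ parent w ∷ map parent (reverse ns′)
  code-after-last-N {ns′} {w} ns≡ = begin
    map parent (ps ++ reverse ns)                ≡⟨ map-++ parent ps (reverse ns) ⟩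
    parents ++ map parent (reverse ns)           ≡⟨ cong (λ l → parents ++ map parent (reverse l)) ns≡ ⟩
    parents ++ map parent (reverse (ns′ ∷ʳ w))   ≡⟨ cong (λ l → parents ++ map parent l) (reverse-++ ns′ (w ∷ [])) ⟩
    parents ++ parent w ∷ map parent (reverse ns′) ∎
    where open ≡-Reasoning

  take-1+p-code : ∀ {ns′ w} → ns ≡ ns′ ∷ʳ w → take (suc p) code ≡ parents ∷ʳ parent w
  take-1+p-code ns≡ = trans (cong₂ (λ k → take (suc k)) (sym (length-map parent ps)) (code-after-last-N ns≡))
                            (take-suc-length-++ parents _ _)

  drop-p∸1-code : ∀ {ps′ c ns′ w} → ps ≡ ps′ ∷ʳ c → ns ≡ ns′ ∷ʳ w →
                  drop (p ∸ 1) code ≡ parent c ∷ parent w ∷ map parent (reverse ns′)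
  drop-p∸1-code {ps′} {c} {ns′} {w} ps≡ ns≡ = begin
    drop (p ∸ 1) code                             ≡⟨ cong₂ drop p∸1≡ (code-after-last-N ns≡) ⟩
    drop (length pre) (parents ++ rest)           ≡⟨ cong (λ l → drop (length pre) (map parent l ++ rest)) ps≡ ⟩
    drop (length pre) (map parent (ps′ ∷ʳ c) ++ rest)
      ≡⟨ cong (λ l → drop (length pre) (l ++ rest)) (map-++ parent ps′ (c ∷ [])) ⟩
    drop (length pre) ((pre ∷ʳ parent c) ++ rest) ≡⟨ cong (drop (length pre)) (++-assoc pre (parent c ∷ []) rest) ⟩
    drop (length pre) (pre ++ parent c ∷ rest)    ≡⟨ drop-length-++ pre (parent c ∷ rest) ⟩
    parent c ∷ rest                               ∎
    where
    open ≡-Reasoning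
    pre rest : List (Fin n)
    pre  = map parent ps′
    rest = parent w ∷ map parent (reverse ns′)
    p∸1≡ : p ∸ 1 ≡ length pre
    p∸1≡ = trans (cong (λ l → length l ∸ 1) ps≡)
                 (trans (cong (_∸ 1) (length-++ ps′)) (trans (m+n∸n≡m (length ps′) 1) (sym (length-map parent ps′))))

  parent-of-last-N-P : ∀ {ns′ w} → ns ≡ ns′ ∷ʳ w → parent w ≢ root → IsP T (parent w)
  parent-of-last-N-P {ns′} {w} ns≡ pw≢root
    with A , B , _ , ord≡ , _ , allP ← Split-after-last-N T ns′ w (subst (Split T ord ps) ns≡ sp) =
    All.lookup allP (parent-later A w B ord≡ pw≢root)

  -- Only P-positions are removed after the last N-position w; there is at least one, parent w,
  -- so the last P-position c is the last removed vertex.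
  last-P-child-of-root : ∀ {ps′ c ns′ w} → ps ≡ ps′ ∷ʳ c → ns ≡ ns′ ∷ʳ w → parent w ≢ root → parent c ≡ root
  last-P-child-of-root {ps′} {c} {ns′} {w} ps≡ ns≡ pw≢root
    with A , B , ps₀ , ord≡ , ps≡ps₀++B , _ ← Split-after-last-N T ns′ w (subst (Split T ord ps) ns≡ sp) =
    from-tail A ps₀ ord≡ ps≡ps₀++B (∷ʳ-view B (∈⇒length>0 (parent-later A w B ord≡ pw≢root)))
    where
    from-tail : ∀ A ps₀ {B} → ord ≡ A ++ w ∷ B → ps ≡ ps₀ ++ B → (∃₂ λ B′ c′ → B ≡ B′ ∷ʳ c′) → parent c ≡ root
    from-tail A ps₀ ord≡ ps≡ps₀++B (B′ , c′ , refl) =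
      subst (λ v → parent v ≡ root) (sym c≡c′)
        (last-removed-child-of-root (A ++ w ∷ B′) c′ (trans ord≡ (sym (++-assoc A (w ∷ B′) (c′ ∷ [])))))
      where
      c≡c′ : c ≡ c′
      c≡c′ = ∷ʳ-injectiveʳ ps′ (ps₀ ++ B′) (trans (sym ps≡) (trans ps≡ps₀++B (sym (++-assoc ps₀ B′ (c′ ∷ [])))))

  module RootP (rootP : IsP T root) where

    N⇒≢root : ∀ {v} → IsN T v → v ≢ root
    N⇒≢root vN refl = P⇒¬N T rootP vN

    D-p : D p ≡ q
    D-p = trans (cong #distinct take-p-code)
                (#distinct-Unique (Split-Unique-N T sp (Greedy-Unique T G))
                   (λ v∈ → let vN = ∈parents⇒N v∈ in N⇒∈ns vN (N⇒≢root vN))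
                   (λ v∈ → N⇒∈parents (proj₁ (Split-N T sp v∈))))

    -- The last removed vertex is a child of the P-position root, hence an N-position.
    ns-nonempty : 0 < q
    ns-nonempty with A , c , ord≡ ← ∷ʳ-view ord (subst (0 <_) (sym len) (m<n⇒0<n∸m n≥2)) =
      ∈⇒length>0 (N⇒∈ns (P⇒children-N T rootP c (c≢root , last-removed-child-of-root A c ord≡)) c≢root)
      where
      c≢root : c ≢ root
      c≢root = Greedy-≢root T G (subst (c ∈_) (sym ord≡) (∈-++⁺ʳ A (here refl)))

    no-threshold : ∀ {α} → (∀ β → β < α → D β < n ∸ β) → D α ≢ n ∸ α
    no-threshold below at with ns′ , w , ns≡ ← ∷ʳ-view ns ns-nonempty =
      threshold-not-jumped (subst₂ _<_ (sym D-p) (sym n∸p≡1+q) ≤-refl)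
                           (subst₂ _<_ (sym n∸1+p≡q) (sym D-1+p) ≤-refl)
      where
      open Threshold D D-mono below at
      x : Fin n
      x = parent w
      x-P : IsP T x
      x-P with x ≟ᶠ root
      ... | yes x≡root = subst (IsP T) (sym x≡root) rootP
      ... | no x≢root  = parent-of-last-N-P ns≡ x≢root
      x∉ns : All (x ≢_) ns
      x∉ns = All.tabulate λ v∈ x≡v → P⇒¬N T x-P (subst (IsN T) (sym x≡v) (proj₁ (Split-N T sp v∈)))
      ⊆x∷ns : parents ∷ʳ x ⊆ x ∷ ns
      ⊆x∷ns v∈ with ∈-++⁻ parents v∈
      ... | inj₁ v∈parents = let vN = ∈parents⇒N v∈parents in there (N⇒∈ns vN (N⇒≢root vN))
      ... | inj₂ (here v≡x) = here v≡x
      x∷ns⊆ : x ∷ ns ⊆ parents ∷ʳ x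
      x∷ns⊆ (here v≡x) = ∈-++⁺ʳ parents (here v≡x)
      x∷ns⊆ (there v∈) = ∈-++⁺ˡ (N⇒∈parents (proj₁ (Split-N T sp v∈)))
      D-1+p : D (suc p) ≡ suc q
      D-1+p = trans (cong #distinct (take-1+p-code ns≡))
                    (#distinct-Unique (x∉ns ∷ Split-Unique-N T sp (Greedy-Unique T G)) ⊆x∷ns x∷ns⊆)

  module RootN (rootN : IsN T root) where

    P⇒≢root : ∀ {v} → IsP T v → v ≢ root
    P⇒≢root vP refl = P⇒¬N T vP rootN

    D-p : D p ≡ n ∸ p
    D-p = trans (cong #distinct take-p-code)
                (trans (#distinct-Unique (root∉ns ∷ Split-Unique-N T sp (Greedy-Unique T G)) ⊆root∷ns root∷ns⊆)
                       (sym n∸p≡1+q))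
      where
      root∉ns : All (root ≢_) ns
      root∉ns = All.tabulate λ v∈ root≡v → ns-≢root v∈ (sym root≡v)
      ⊆root∷ns : parents ⊆ root ∷ ns
      ⊆root∷ns {v} v∈ with v ≟ᶠ root
      ... | yes v≡root = here v≡root
      ... | no v≢root  = there (N⇒∈ns (∈parents⇒N v∈) v≢root)
      root∷ns⊆ : root ∷ ns ⊆ parents
      root∷ns⊆ (here refl) = N⇒∈parents rootN
      root∷ns⊆ (there v∈)  = N⇒∈parents (proj₁ (Split-N T sp v∈))

    α≡p : ∀ {α} → (∀ β → β < α → D β < n ∸ β) → D α ≡ n ∸ α → α ≡ p
    α≡p below at = threshold-unique (subst (p ≤_) (sym n≡1+p+q) (≤-trans (m≤m+n p q) (n≤1+n (p + q)))) D-p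
      where open Threshold D D-mono below at

    P⇔∉take-p : ∀ v → IsP T v ⇔ v ∉ take p code
    P⇔∉take-p v = mk⇔ (λ vP v∈ → P⇒¬N T vP (∈parents⇒N (subst (v ∈_) take-p-code v∈))) ∉⇒P
      where
      ∉⇒P : v ∉ take p code → IsP T v
      ∉⇒P v∉ with classify v
      ... | inj₁ vP = vP
      ... | inj₂ vN = ⊥-elim (v∉ (subst (v ∈_) (sym take-p-code) (N⇒∈parents vN)))

    ps-nonempty : 0 < p
    ps-nonempty with u , (u≢root , _) , uP ← N⇒P-child T rootN = ∈⇒length>0 (P⇒∈ps uP u≢root)

    next-two : ∀ y x rest → p + 1 ≤ n ∸ 1 → drop (p ∸ 1) code ≡ y ∷ x ∷ rest →
               (x ∈ take p code → x ≡ root) × (x ∉ take p code → y ≡ root)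
    next-two y x rest p+1≤ drop≡
      with ns′ , w , ns≡ ← ∷ʳ-view ns (+-cancelˡ-≤ p 1 q (subst (p + 1 ≤_) n∸1≡p+q p+1≤))
         | ps′ , c , ps≡ ← ∷ʳ-view ps ps-nonempty =
      x-root , y-root
      where
      y∷x∷rest≡ : y ∷ x ∷ rest ≡ parent c ∷ parent w ∷ map parent (reverse ns′)
      y∷x∷rest≡ = trans (sym drop≡) (drop-p∸1-code ps≡ ns≡)
      y≡pc : y ≡ parent c
      y≡pc = proj₁ (∷-injective y∷x∷rest≡)
      x≡pw : x ≡ parent w
      x≡pw = proj₁ (∷-injective (proj₂ (∷-injective y∷x∷rest≡)))
      x-root : x ∈ take p code → x ≡ root
      x-root x∈ with parent w ≟ᶠ root
      ... | yes pw≡root = trans x≡pw pw≡root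
      ... | no pw≢root  = ⊥-elim (P⇒¬N T (subst (IsP T) (sym x≡pw) (parent-of-last-N-P ns≡ pw≢root))
                                          (∈parents⇒N (subst (x ∈_) take-p-code x∈)))
      y-root : x ∉ take p code → y ≡ root
      y-root x∉ = trans y≡pc (last-P-child-of-root ps≡ ns≡ λ pw≡root →
                    P⇒≢root (Equivalence.from (P⇔∉take-p x) x∉) (trans x≡pw pw≡root))

    has-P-child? : ∀ v → Dec (∃ λ u → Child T u v × IsP T u)
    has-P-child? v = any? (P-child? T v λ u _ → classify u)

    -- Injects every independent set into ps: a vertex without P-child is itself a P-position.
    partner : Fin n → Fin n
    partner v with has-P-child? v
    ... | yes (u , _) = u
    ... | no _        = v

    partner-∈ps : ∀ v → partner v ∈ ps
    partner-∈ps v with has-P-child? v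
    ... | yes (u , (u≢root , _) , uP) = P⇒∈ps uP u≢root
    ... | no ∄P-child with classify v
    ...   | inj₁ vP = P⇒∈ps vP (P⇒≢root vP)
    ...   | inj₂ vN = ⊥-elim (∄P-child (N⇒P-child T vN))

    partner-injective : ∀ J → Independent T J → ∀ {a b} → a S.∈ J → b S.∈ J → partner a ≡ partner b → a ≡ b
    partner-injective J indep {a} {b} a∈ b∈ with has-P-child? a | has-P-child? b
    ... | yes (u , (_ , pu≡a) , _) | yes (u′ , (_ , pu′≡b) , _) = λ u≡u′ → trans (sym pu≡a) (trans (cong parent u≡u′) pu′≡b)
    ... | yes (u , u→a , _)         | no _ = λ u≡b → ⊥-elim (indep u a (subst (S._∈ J) (sym u≡b) b∈) a∈ u→a)
    ... | no _                      | yes (u′ , u′→b , _) = λ a≡u′ → ⊥-elim (indep u′ b (subst (S._∈ J) a≡u′ a∈) b∈ u′→b)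
    ... | no _                      | no _ = λ a≡b → a≡b

    Independent⇒∣∣≤p : ∀ J → Independent T J → ∣ J ∣ ≤ p
    Independent⇒∣∣≤p J indep =
      subst (_≤ p) (trans (length-map partner (elements J)) (length-elements J))
        (Unique⇒length-≤
          (Unique-map⁺ partner (λ a∈ b∈ → partner-injective J indep (∈-elements⁻ a∈) (∈-elements⁻ b∈)) (elements-Unique J))
          (λ v∈ → let a , _ , v≡ = ∈-map⁻ partner v∈ in subst (_∈ ps) (sym v≡) (partner-∈ps a)))

    ∣P-positions∣≡p : ∀ (I : Subset n) → (∀ v → v S.∈ I ⇔ IsP T v) → ∣ I ∣ ≡ p
    ∣P-positions∣≡p I I⇔P =
      trans (sym (length-elements I))
        (Unique⇒length-≡ (elements-Unique I) (Split-Unique-P T sp (Greedy-Unique T G))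
          (λ v∈ → let vP = Equivalence.to (I⇔P _) (∈-elements⁻ v∈) in P⇒∈ps vP (P⇒≢root vP))
          (λ v∈ → ∈-elements⁺ (Equivalence.from (I⇔P _) (proj₁ (Split-P T sp v∈)))))

    P-positions-maximum : ∀ (I : Subset n) → (∀ v → v S.∈ I ⇔ v ∉ take p code) →
                          ∣ I ∣ ≡ p × MaximumIndependent T I
    P-positions-maximum I I⇔∉ =
      ∣I∣≡p , P-positions-Independent T I (λ v∈ → Equivalence.to (I⇔P _) v∈) ,
      λ J indep → subst (∣ J ∣ ≤_) (sym ∣I∣≡p) (Independent⇒∣∣≤p J indep)
      where
      I⇔P : ∀ v → v S.∈ I ⇔ IsP T v
      I⇔P v = ⇔.trans (I⇔∉ v) (⇔.sym (P⇔∉take-p v))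
      ∣I∣≡p : ∣ I ∣ ≡ p
      ∣I∣≡p = ∣P-positions∣≡p I I⇔P

  root-N×α≡p : ∀ {α} → (∀ β → β < α → D β < n ∸ β) → D α ≡ n ∸ α → IsN T root × α ≡ p
  root-N×α≡p below at with classify root
  ... | inj₁ rootP = ⊥-elim (RootP.no-threshold rootP below at)
  ... | inj₂ rootN = rootN , RootN.α≡p rootN below at

proposition8 : (n : ℕ) → 2 ≤ n → (T : RootedTree n) → (s : List (Fin n)) →
    SlitherCode T s → (α : ℕ) →
    (∀ β → β < α → #distinct (take β s) < n ∸ β) →
    #distinct (take α s) ≡ n ∸ α →
    IsN T (RootedTree.root T)
    × (∀ y x rest → α + 1 ≤ n ∸ 1 → drop (α ∸ 1) s ≡ y ∷ x ∷ rest →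
         (x ∈ take α s → x ≡ RootedTree.root T)
         × (x ∉ take α s → y ≡ RootedTree.root T))
    × (∀ v → IsP T v ⇔ v ∉ take α s)
    × (∀ (I : Subset n) → (∀ v → v S.∈ I ⇔ v ∉ take α s) →
         ∣ I ∣ ≡ α × MaximumIndependent T I)
proposition8 n n≥2 T _ (ord , ps , ns , G , len , sp , refl) α below at
  with rootN , refl ← RemovalOrder.root-N×α≡p T n≥2 G len sp below at =
  rootN , next-two , P⇔∉take-p , P-positions-maximum
  where open RemovalOrder T n≥2 G len sp; open RootN rootN
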